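{- Let $(a_n)_{n\ge 0}$ be a sequence of real numbers, $S_n(q)=\sum_{k=0}^{n}a_k\binom{n}{k}(1-q)^kq^{n-k}$, and let $m\ge 0$ be an integer. Then for every $n\ge 0$, $$(1-q)^m\sum_{k=0}^{n}S_{k+m}(x)\binom{n}{k}(1-q)^kq^{n-k}=\sum_{j=0}^{m}\binom{m}{j}(-q)^{m-j}S_{j+n}(x+q-xq),$$ i.e. the sequence $\left(\sum_{j=0}^{m}\binom{m}{j}(-q)^{m-j}S_{j+n}(x+q-xq)\right)_{n\ge0}$ is the Bernoulli transform (with parameter $q$) of the sequence $\left((1-q)^mS_{n+m}(x)\right)_{n\ge0}$. In particular, taking $n=0$, $$(1-q)^mS_m(x)=\sum_{j=0}^{m}\binom{m}{j}(-q)^{m-j}S_j(x+q-xq).$$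
   Context: The Bernoulli transform with parameter $q$ of a sequence $(b_n)_{n\ge0}$ is the sequence $\left(\sum_{k=0}^{n}b_k\binom{n}{k}(1-q)^kq^{n-k}\right)_{n\ge0}$. -}

module Defs where

open import Algebra.Bundles using (CommutativeRing)
open import Data.Nat as ℕ using (ℕ; zero; suc; _∸_)
open import Data.Nat.Combinatorics using (_C_)

-- Everything is stated over an arbitrary commutative ring R
-- (the paper works over the reals).
module Bern {c ℓ} (R : CommutativeRing c ℓ) where
  open CommutativeRing R

  pow : Carrier → ℕ → Carrier
  pow x zero    = 1#
  pow x (suc k) = x * pow x k

  fromℕ : ℕ → Carrier
  fromℕ zero    = 0#
  fromℕ (suc k) = 1# + fromℕ k

  Σ≤ : ℕ → (ℕ → Carrier) → Carrier
  Σ≤ zero    f = f 0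
  Σ≤ (suc n) f = Σ≤ n f + f (suc n)

  bernoulli : Carrier → (ℕ → Carrier) → ℕ → Carrier
  bernoulli q b n =
    Σ≤ n (λ k → b k * (fromℕ (n C k) * (pow (1# - q) k * pow q (n ∸ k))))

  S : (ℕ → Carrier) → Carrier → ℕ → Carrier
  S a q n = bernoulli q a n

{-# OPTIONS --safe #-}
-- Write T u v b n = Σₖ bₖ C(n,k) uᵏ vⁿ⁻ᵏ, so that the Bernoulli transform with parameter q
-- is T (1 - q) q. Pascal's rule gives T b (n + 1) = v T b n + u T (E b) n, where E is the
-- shift, i.e. (E - v) T = u T E; iterating, (E - v)ᵐ T = uᵐ T Eᵐ. The same recursion also
-- characterises composites: T u v ∘ T u′ v′ = T (u u′) (v + u v′), which for u = 1 - q,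
-- u′ = 1 - x says S(x + q - x q) = T (1 - q) q S(x). Applying (E - q)ᵐ, expanded binomially,
-- to S(x + q - x q) gives the identity.
module Submission where

open import Algebra.Bundles using (CommutativeRing)
open import Data.Nat using (ℕ; zero; suc; _+_; _∸_; _<_; _≤?_)
open import Data.Nat.Combinatorics using (_C_; k>n⇒nCk≡0; nCk+nC[k+1]≡[n+1]C[k+1])
import Data.Nat.Properties as ℕ
import Relation.Binary.PropositionalEquality as ≡
open import Relation.Nullary using (yes; no)

open import Defs

module BinomialTransform {c ℓ} (R : CommutativeRing c ℓ) where

  open CommutativeRing R renaming (_+_ to _⊕_) hiding (zero)
  open Bern R
  open import Algebra.Properties.CommutativeSemigroup *-commutativeSemigroup using (x∙yz≈y∙xz)
  open import Algebra.Properties.Group +-group using (\\-leftDividesʳ)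
  open import Algebra.Properties.Ring ring using (-‿+-comm; -‿distribˡ-*; [y-z]x≈yx-zx; x[y-z]≈xy-xz)
  open import Algebra.Solver.Ring.NaturalCoefficients.Default commutativeSemiring
    using (solve; _:=_; _:+_; _:*_)
  open import Relation.Binary.Reasoning.Setoid setoid

  Σ≤-cong : ∀ n {f g : ℕ → Carrier} → (∀ k → f k ≈ g k) → Σ≤ n f ≈ Σ≤ n g
  Σ≤-cong zero    f≈g = f≈g 0
  Σ≤-cong (suc n) f≈g = +-cong (Σ≤-cong n f≈g) (f≈g (suc n))

  linear-interchange : ∀ α β a b c d →
                       (α * a ⊕ β * b) ⊕ (α * c ⊕ β * d) ≈ α * (a ⊕ c) ⊕ β * (b ⊕ d)
  linear-interchange = solve 6 (λ α β a b c d →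
    (α :* a :+ β :* b) :+ (α :* c :+ β :* d) := α :* (a :+ c) :+ β :* (b :+ d)) refl

  Σ≤-linear : ∀ n α β (f g : ℕ → Carrier) →
              Σ≤ n (λ k → α * f k ⊕ β * g k) ≈ α * Σ≤ n f ⊕ β * Σ≤ n g
  Σ≤-linear zero    α β f g = refl
  Σ≤-linear (suc n) α β f g =
    trans (+-cong (Σ≤-linear n α β f g) refl) (linear-interchange α β _ _ _ _)

  Σ≤-pascal : ∀ {u v} {f g h : ℕ → Carrier} →
              f 0 ≈ v * g 0 → (∀ k → f (suc k) ≈ v * g (suc k) ⊕ u * h k) →
              ∀ n → Σ≤ (suc n) f ≈ v * Σ≤ (suc n) g ⊕ u * Σ≤ n h
  Σ≤-pascal {u} {v} {f} {g} {h} f0 fsuc zero = begin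
    f 0 ⊕ f 1                      ≈⟨ +-cong f0 (fsuc 0) ⟩
    v * g 0 ⊕ (v * g 1 ⊕ u * h 0)  ≈⟨ sym (+-assoc _ _ _) ⟩
    (v * g 0 ⊕ v * g 1) ⊕ u * h 0  ≈⟨ +-cong (sym (distribˡ v _ _)) refl ⟩
    v * (g 0 ⊕ g 1) ⊕ u * h 0      ∎
  Σ≤-pascal f0 fsuc (suc n) =
    trans (+-cong (Σ≤-pascal f0 fsuc n) (fsuc (suc n))) (linear-interchange _ _ _ _ _ _)

  fromℕ-homo-+ : ∀ a b → fromℕ (a + b) ≈ fromℕ a ⊕ fromℕ b
  fromℕ-homo-+ zero    b = sym (+-identityˡ _)
  fromℕ-homo-+ (suc a) b = trans (+-cong refl (fromℕ-homo-+ a b)) (sym (+-assoc _ _ _))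

  binomialWeight : Carrier → Carrier → ℕ → ℕ → Carrier
  binomialWeight u v n k = fromℕ (n C k) * (pow u k * pow v (n ∸ k))

  binomialTransform : Carrier → Carrier → (ℕ → Carrier) → ℕ → Carrier
  binomialTransform u v b n = Σ≤ n (λ k → b k * binomialWeight u v n k)

  binomialWeight-vanishes : ∀ u v {n k} → n < k → binomialWeight u v n k ≈ 0#
  binomialWeight-vanishes u v n<k =
    trans (*-cong (reflexive (≡.cong fromℕ (k>n⇒nCk≡0 n<k))) refl) (zeroˡ _)

  binomialWeight-suc-zero : ∀ u v n → binomialWeight u v (suc n) 0 ≈ v * binomialWeight u v n 0
  binomialWeight-suc-zero u v n =
    trans (*-cong refl (x∙yz≈y∙xz (pow u 0) v (pow v n))) (x∙yz≈y∙xz _ v _)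

  -- n ∸ j ≡ suc (n ∸ suc j) fails when n ≤ j (truncated subtraction), but then the
  -- binomial coefficient vanishes.
  choose-pow-∸-suc : ∀ v n j →
                     fromℕ (n C suc j) * pow v (n ∸ j)
                       ≈ v * (fromℕ (n C suc j) * pow v (n ∸ suc j))
  choose-pow-∸-suc v n j with suc j ≤? n
  ... | yes j<n = trans (*-cong refl (reflexive (≡.cong (pow v) (ℕ.+-∸-assoc 1 j<n))))
                        (x∙yz≈y∙xz _ v _)
  ... | no  j≮n = begin
    fromℕ (n C suc j) * pow v (n ∸ j)                 ≈⟨ *-cong C≈0 refl ⟩
    0# * pow v (n ∸ j)                                ≈⟨ zeroˡ _ ⟩
    0#                                                ≈⟨ sym (zeroʳ v) ⟩
    v * 0#                                            ≈⟨ *-cong refl (sym (zeroˡ _)) ⟩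
    v * (0# * pow v (n ∸ suc j))                      ≈⟨ *-cong refl (*-cong (sym C≈0) refl) ⟩
    v * (fromℕ (n C suc j) * pow v (n ∸ suc j))       ∎
    where
    C≈0 : fromℕ (n C suc j) ≈ 0#
    C≈0 = reflexive (≡.cong fromℕ (k>n⇒nCk≡0 (ℕ.≰⇒> j≮n)))

  binomialWeight-suc : ∀ u v n j →
                       binomialWeight u v (suc n) (suc j)
                         ≈ v * binomialWeight u v n (suc j) ⊕ u * binomialWeight u v n j
  binomialWeight-suc u v n j = begin
    fromℕ (suc n C suc j) * (u * pow u j * pow v (n ∸ j))
      ≈⟨ *-cong pascal refl ⟩
    (A ⊕ B) * (u * pow u j * pow v (n ∸ j))
      ≈⟨ solve 5 (λ A B u U V →
             (A :+ B) :* (u :* U :* V) := u :* U :* (B :* V) :+ u :* (A :* (U :* V)))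
           refl A B u (pow u j) (pow v (n ∸ j)) ⟩
    u * pow u j * (B * pow v (n ∸ j)) ⊕ u * binomialWeight u v n j
      ≈⟨ +-cong (*-cong refl (choose-pow-∸-suc v n j)) refl ⟩
    u * pow u j * (v * (B * pow v (n ∸ suc j))) ⊕ u * binomialWeight u v n j
      ≈⟨ +-cong (solve 4 (λ U v B V → U :* (v :* (B :* V)) := v :* (B :* (U :* V))) refl
                  (u * pow u j) v B (pow v (n ∸ suc j))) refl ⟩
    v * binomialWeight u v n (suc j) ⊕ u * binomialWeight u v n j
      ∎
    where
    A = fromℕ (n C j)
    B = fromℕ (n C suc j)
    pascal : fromℕ (suc n C suc j) ≈ A ⊕ B
    pascal = trans (reflexive (≡.cong fromℕ (≡.sym (nCk+nC[k+1]≡[n+1]C[k+1] n j))))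
                   (fromℕ-homo-+ (n C j) (n C suc j))

  binomialTransform-cong : ∀ u v n {b b′ : ℕ → Carrier} → (∀ k → b k ≈ b′ k) →
                           binomialTransform u v b n ≈ binomialTransform u v b′ n
  binomialTransform-cong u v n b≈b′ = Σ≤-cong n (λ k → *-cong (b≈b′ k) refl)

  binomialTransform-zero : ∀ u v b → binomialTransform u v b 0 ≈ b 0
  binomialTransform-zero u v b =
    trans (*-cong refl (trans (*-cong (+-identityʳ 1#) (*-identityˡ 1#)) (*-identityˡ 1#)))
          (*-identityʳ (b 0))

  binomialTransform-suc : ∀ u v b n →
                          binomialTransform u v b (suc n)
                            ≈ v * binomialTransform u v b n ⊕ u * binomialTransform u v (λ k → b (suc k)) n
  binomialTransform-suc u v b n = begin
    T b (suc n)
      ≈⟨ Σ≤-pascal head tail n ⟩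
    v * (T b n ⊕ b (suc n) * W n (suc n)) ⊕ u * T (λ k → b (suc k)) n
      ≈⟨ +-cong (*-cong refl (+-cong refl (*-cong refl top≈0))) refl ⟩
    v * (T b n ⊕ b (suc n) * 0#) ⊕ u * T (λ k → b (suc k)) n
      ≈⟨ +-cong (*-cong refl (trans (+-cong refl (zeroʳ _)) (+-identityʳ _))) refl ⟩
    v * T b n ⊕ u * T (λ k → b (suc k)) n
      ∎
    where
    T = binomialTransform u v
    W = binomialWeight u v
    top≈0 : W n (suc n) ≈ 0#
    top≈0 = binomialWeight-vanishes u v (ℕ.n<1+n n)
    head : b 0 * W (suc n) 0 ≈ v * (b 0 * W n 0)
    head = trans (*-cong refl (binomialWeight-suc-zero u v n)) (x∙yz≈y∙xz _ _ _)
    tail : ∀ k → b (suc k) * W (suc n) (suc k)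
                   ≈ v * (b (suc k) * W n (suc k)) ⊕ u * (b (suc k) * W n k)
    tail k = trans (*-cong refl (binomialWeight-suc u v n k))
                   (trans (distribˡ _ _ _) (+-cong (x∙yz≈y∙xz _ _ _) (x∙yz≈y∙xz _ _ _)))

  binomialTransform-linear : ∀ u v n α β (f g : ℕ → Carrier) →
                             binomialTransform u v (λ k → α * f k ⊕ β * g k) n
                               ≈ α * binomialTransform u v f n ⊕ β * binomialTransform u v g n
  binomialTransform-linear u v n α β f g =
    trans (Σ≤-cong n (λ k → trans (distribʳ _ _ _) (+-cong (*-assoc _ _ _) (*-assoc _ _ _))))
          (Σ≤-linear n α β _ _)

  binomialTransform-∘ : ∀ {u v u′ v′ u″ v″} → u″ ≈ u * u′ → v″ ≈ v ⊕ u * v′ → ∀ n b →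
                        binomialTransform u v (binomialTransform u′ v′ b) n
                          ≈ binomialTransform u″ v″ b n
  binomialTransform-∘ {u} {v} {u′} {v′} {u″} {v″} u″≈ v″≈ = composite
    where
    T  = binomialTransform u v
    T′ = binomialTransform u′ v′
    T″ = binomialTransform u″ v″
    composite : ∀ n b → T (T′ b) n ≈ T″ b n
    composite zero b = begin
      T (T′ b) 0  ≈⟨ binomialTransform-zero u v (T′ b) ⟩
      T′ b 0      ≈⟨ binomialTransform-zero u′ v′ b ⟩
      b 0         ≈⟨ sym (binomialTransform-zero u″ v″ b) ⟩
      T″ b 0      ∎
    composite (suc n) b = begin
      T (T′ b) (suc n)
        ≈⟨ binomialTransform-suc u v (T′ b) n ⟩
      v * T (T′ b) n ⊕ u * T (λ k → T′ b (suc k)) n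
        ≈⟨ +-cong refl (*-cong refl (binomialTransform-cong u v n (binomialTransform-suc u′ v′ b))) ⟩
      v * T (T′ b) n ⊕ u * T (λ k → v′ * T′ b k ⊕ u′ * T′ b′ k) n
        ≈⟨ +-cong refl (*-cong refl (binomialTransform-linear u v n v′ u′ _ _)) ⟩
      v * T (T′ b) n ⊕ u * (v′ * T (T′ b) n ⊕ u′ * T (T′ b′) n)
        ≈⟨ solve 6 (λ v u v′ u′ X Y →
               v :* X :+ u :* (v′ :* X :+ u′ :* Y) := (v :+ u :* v′) :* X :+ (u :* u′) :* Y)
             refl v u v′ u′ (T (T′ b) n) (T (T′ b′) n) ⟩
      (v ⊕ u * v′) * T (T′ b) n ⊕ (u * u′) * T (T′ b′) n
        ≈⟨ +-cong (*-cong (sym v″≈) (composite n b)) (*-cong (sym u″≈) (composite n b′)) ⟩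
      v″ * T″ b n ⊕ u″ * T″ b′ n
        ≈⟨ sym (binomialTransform-suc u″ v″ b n) ⟩
      T″ b (suc n) ∎
      where
      b′ = λ k → b (suc k)

  bernoulli-∘ : ∀ q x a n → bernoulli q (bernoulli x a) n ≈ bernoulli ((x ⊕ q) - x * q) a n
  bernoulli-∘ q x a n = binomialTransform-∘ complement parameter n a
    where
    parameter : (x ⊕ q) - x * q ≈ q ⊕ (1# - q) * x
    parameter = begin
      (x ⊕ q) - x * q        ≈⟨ +-cong (+-comm x q) refl ⟩
      (q ⊕ x) - x * q        ≈⟨ +-assoc q x _ ⟩
      q ⊕ (x - x * q)        ≈⟨ +-cong refl (+-cong (sym (*-identityˡ x)) (-‿cong (*-comm x q))) ⟩
      q ⊕ (1# * x - q * x)   ≈⟨ +-cong refl (sym ([y-z]x≈yx-zx x 1# q)) ⟩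
      q ⊕ (1# - q) * x       ∎
    complement : 1# - ((x ⊕ q) - x * q) ≈ (1# - q) * (1# - x)
    complement = begin
      1# - ((x ⊕ q) - x * q)           ≈⟨ +-cong refl (-‿cong parameter) ⟩
      1# - (q ⊕ (1# - q) * x)          ≈⟨ +-cong refl (sym (-‿+-comm q _)) ⟩
      1# ⊕ (- q - (1# - q) * x)        ≈⟨ sym (+-assoc _ _ _) ⟩
      (1# - q) - (1# - q) * x          ≈⟨ +-cong (sym (*-identityʳ _)) refl ⟩
      (1# - q) * 1# - (1# - q) * x     ≈⟨ sym (x[y-z]≈xy-xz (1# - q) 1# x) ⟩
      (1# - q) * (1# - x)              ∎

  -- Δ v m c n is the n-th term of (E - v)ᵐ c, where E is the shift (E c) n = c (1 + n),
  -- expanded by the binomial theorem.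
  Δ : Carrier → ℕ → (ℕ → Carrier) → ℕ → Carrier
  Δ v m c n = binomialTransform 1# (- v) (λ j → c (j + n)) m

  1#-pow : ∀ j → pow 1# j ≈ 1#
  1#-pow zero    = refl
  1#-pow (suc j) = trans (*-identityˡ _) (1#-pow j)

  Δ-expand : ∀ v m c n → Δ v m c n ≈ Σ≤ m (λ j → fromℕ (m C j) * pow (- v) (m ∸ j) * c (j + n))
  Δ-expand v m c n = Σ≤-cong m (λ j → begin
    c (j + n) * (fromℕ (m C j) * (pow 1# j * pow (- v) (m ∸ j)))
      ≈⟨ *-cong refl (*-cong refl (trans (*-cong (1#-pow j) refl) (*-identityˡ _))) ⟩
    c (j + n) * (fromℕ (m C j) * pow (- v) (m ∸ j))
      ≈⟨ *-comm _ _ ⟩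
    fromℕ (m C j) * pow (- v) (m ∸ j) * c (j + n)
      ∎)

  Δ-suc : ∀ v m c n → Δ v (suc m) c n ≈ - v * Δ v m c n ⊕ Δ v m c (suc n)
  Δ-suc v m c n = trans (binomialTransform-suc 1# (- v) _ m)
    (+-cong refl (trans (*-identityˡ _)
      (binomialTransform-cong 1# (- v) m (λ j → reflexive (≡.cong c (≡.sym (ℕ.+-suc j n)))))))

  Δ-binomialTransform : ∀ u v m n s →
                        Δ v m (binomialTransform u v s) n
                          ≈ pow u m * binomialTransform u v (λ k → s (k + m)) n
  Δ-binomialTransform u v zero n s = begin
    Δ v 0 (T s) n
      ≈⟨ binomialTransform-zero 1# (- v) (λ j → T s (j + n)) ⟩
    T s n
      ≈⟨ binomialTransform-cong u v n (λ k → reflexive (≡.cong s (≡.sym (ℕ.+-identityʳ k)))) ⟩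
    T (λ k → s (k + 0)) n
      ≈⟨ sym (*-identityˡ _) ⟩
    1# * T (λ k → s (k + 0)) n
      ∎
    where
    T = binomialTransform u v
  Δ-binomialTransform u v (suc m) n s = begin
    Δ v (suc m) (T s) n
      ≈⟨ Δ-suc v m (T s) n ⟩
    - v * Δ v m (T s) n ⊕ Δ v m (T s) (suc n)
      ≈⟨ +-cong (*-cong refl (Δ-binomialTransform u v m n s)) (Δ-binomialTransform u v m (suc n) s) ⟩
    - v * (pow u m * T s′ n) ⊕ pow u m * T s′ (suc n)
      ≈⟨ +-cong refl (*-cong refl (binomialTransform-suc u v s′ n)) ⟩
    - v * (pow u m * T s′ n) ⊕ pow u m * (v * T s′ n ⊕ u * T (λ k → s′ (suc k)) n)
      ≈⟨ +-cong (sym (-‿distribˡ-* v _))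
                (solve 5 (λ P u v A B → P :* (v :* A :+ u :* B) := v :* (P :* A) :+ (u :* P) :* B)
                   refl (pow u m) u v (T s′ n) (T (λ k → s′ (suc k)) n)) ⟩
    - (v * (pow u m * T s′ n))
      ⊕ (v * (pow u m * T s′ n) ⊕ pow u (suc m) * T (λ k → s′ (suc k)) n)
      ≈⟨ \\-leftDividesʳ _ _ ⟩
    pow u (suc m) * T (λ k → s′ (suc k)) n
      ≈⟨ *-cong refl (binomialTransform-cong u v n (λ k → reflexive (≡.cong s (≡.sym (ℕ.+-suc k m))))) ⟩
    pow u (suc m) * T (λ k → s (k + suc m)) n
      ∎
    where
    T = binomialTransform u v
    s′ = λ k → s (k + m)

mainTheorem8 : ∀ {c ℓ} (R : CommutativeRing c ℓ) →
    let open CommutativeRing R renaming (_+_ to _⊕_)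
        open Bern R
    in (a : ℕ → Carrier) (q x : Carrier) (m n : ℕ) →
       pow (1# - q) m
         * Σ≤ n (λ k → S a x (k + m) * (fromℕ (n C k) * (pow (1# - q) k * pow q (n ∸ k))))
       ≈ Σ≤ m (λ j → fromℕ (m C j) * pow (- q) (m ∸ j) * S a ((x ⊕ q) - (x * q)) (j + n))
mainTheorem8 R a q x m n = begin
  pow (1# - q) m * bernoulli q (λ k → bernoulli x a (k + m)) n
    ≈⟨ sym (Δ-binomialTransform (1# - q) q m n (bernoulli x a)) ⟩
  Δ q m (bernoulli q (bernoulli x a)) n
    ≈⟨ binomialTransform-cong 1# (- q) m (λ j → bernoulli-∘ q x a (j + n)) ⟩
  Δ q m (bernoulli ((x ⊕ q) - x * q) a) n
    ≈⟨ Δ-expand q m (bernoulli ((x ⊕ q) - x * q) a) n ⟩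
  Σ≤ m (λ j → fromℕ (m C j) * pow (- q) (m ∸ j) * bernoulli ((x ⊕ q) - x * q) a (j + n))
    ∎
  where
  open CommutativeRing R renaming (_+_ to _⊕_)
  open Bern R
  open BinomialTransform R
  open import Relation.Binary.Reasoning.Setoid setoid
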